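{- Let $L \subseteq \mathbb{N}$ be such that $L$-cycles have the Erd\H{o}s-P\'osa property. Then there exists $L' \subseteq \mathbb{N}$ such that $L'$-cycles do not have the Erd\H{o}s-P\'osa property and the symmetric difference $L \,\Delta\, L'$ has lower density zero.
   Context: $\mathbb{N}$ denotes the set of positive integers. Graphs are finite. For $L \subseteq \mathbb{N}$, an $L$-cycle is a cycle whose length (number of edges) lies in $L$. $L$-cycles have the Erd\H{o}s-P\'osa property if there is a function $f:\mathbb{N}\to\mathbb{N}$ such that for all $k \in \mathbb{N}$ and all graphs $G$, either $G$ contains $k$ pairwise vertex-disjoint $L$-cycles, or there exists $X \subseteq V(G)$ with $|X| \leq f(k)$ such that $G - X$ has no $L$-cycle. The lower density of $A \subseteq \mathbb{N}$ is $\underline{d}(A) := \liminf_{n\to\infty} \frac{|A \cap \{1,\dots,n\}|}{n}$. -}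

module Defs where

open import Data.Nat using (ℕ; zero; suc; _+_; _*_; _≤_; _<_)
open import Data.Bool using (Bool; true; false; _xor_)
open import Data.Fin using (Fin; zero; suc; inject₁; fromℕ)
open import Data.Fin.Subset using (Subset; _∈_; ∣_∣)
open import Data.Product using (Σ; ∃; _×_; _,_)
open import Data.Sum using (_⊎_)
open import Data.Empty using (⊥)
open import Relation.Nullary using (¬_)
open import Relation.Binary.PropositionalEquality using (_≡_; _≢_)

-- A subset of ℕ is given by its characteristic function.
-- (Only positive integers matter; the value at 0 is irrelevant everywhere.)
SubsetN : Set
SubsetN = ℕ → Bool

record Graph : Set where
  field
    n      : ℕ
    E      : Fin n → Fin n → Bool
    E-sym  : ∀ u v → E u v ≡ E v u
    E-irr  : ∀ v → E v v ≡ false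

open Graph public

record Cycle (G : Graph) : Set where
  field
    len     : ℕ
    len≥3   : 3 ≤ len
    v       : Fin (suc len) → Fin (n G)
    closed  : v zero ≡ v (fromℕ len)
    adj     : ∀ (i : Fin len) → E G (v (inject₁ i)) (v (suc i)) ≡ true
    inj     : ∀ (i j : Fin len) → v (inject₁ i) ≡ v (inject₁ j) → i ≡ j

open Cycle public

OnCycle : {G : Graph} → Cycle G → Fin (n G) → Set
OnCycle C x = ∃ λ (i : Fin (len C)) → v C (inject₁ i) ≡ x

IsLCycle : {G : Graph} → SubsetN → Cycle G → Set
IsLCycle L C = L (len C) ≡ true

Disjoint : {G : Graph} → Cycle G → Cycle G → Set
Disjoint C D = ∀ x → OnCycle C x → OnCycle D x → ⊥

HasDisjointLCycles : SubsetN → ℕ → Graph → Set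
HasDisjointLCycles L k G =
  Σ (Fin k → Cycle G) λ Cs →
    (∀ i → IsLCycle L (Cs i)) × (∀ i j → i ≢ j → Disjoint (Cs i) (Cs j))

HitsAllLCycles : SubsetN → (G : Graph) → Subset (n G) → Set
HitsAllLCycles L G X = ∀ (C : Cycle G) → IsLCycle L C → ∃ λ x → OnCycle C x × x ∈ X

ErdosPosa : SubsetN → Set
ErdosPosa L =
  Σ (ℕ → ℕ) λ f → ∀ (k : ℕ) (G : Graph) →
    HasDisjointLCycles L k G ⊎ (Σ (Subset (n G)) λ X → ∣ X ∣ ≤ f k × HitsAllLCycles L G X)

count : SubsetN → ℕ → ℕ
count A zero = 0
count A (suc m) with A (suc m)
... | true  = suc (count A m)
... | false = count A m

-- lower density zero: liminf_m |A ∩ [1,m]| / m = 0, i.e.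
-- for every ε = 1/(k+1) and every N there is m ≥ N with |A ∩ [1,m]|/m < ε
LowerDensityZero : SubsetN → Set
LowerDensityZero A = ∀ (k N : ℕ) → ∃ λ m → N ≤ m × suc k * count A m < m

SymDiff : SubsetN → SubsetN → SubsetN
SymDiff A B i = A i xor B i

module Submission where

-- The set windowed L agrees with L outside a union of windows (low c, high c];
-- inside the c-th window it consists of the lengths l with high c < 2 l.  Since low (c + 1)
-- is (c + 2) times larger than high c, the symmetric difference has density below 1/(c + 2)
-- at low (c + 1).
--
-- For every c there is a graph on high c vertices all of whose cycles have length in the
-- c-th window: subdivide the digraph on 2c + 2 rows which has a very long "spine" arc
-- start i → end i for every row and a short "link" arc end u → start w for every pair of
-- rows.  Branch vertices are pairwise non-adjacent, so every cycle runs through a whole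
-- subdivided arc and is longer than low c.  The windowed-L-cycles of this graph are those
-- through more than half of its vertices, so no two of them are disjoint; but c vertices
-- meet at most c rows, and the cycle through the spines of c + 2 untouched rows covers more
-- than half of the graph.  So windowed L fails the Erdős–Pósa property already for k = 2.

open import Defs
open import Data.Bool using (true; false)
open import Data.Bool.Properties using (∨-comm; xor-same)
open import Data.Empty using (⊥)
open import Data.Fin using (Fin; zero; suc; toℕ; fromℕ; fromℕ<; inject₁; splitAt)
open import Data.Fin.Properties
  using (toℕ<n; toℕ-fromℕ; toℕ-fromℕ<; fromℕ<-toℕ; toℕ-inject₁; toℕ-injective; inject₁-injective; injective⇒≤; +↔⊎; *↔×)
import Data.Fin.Properties as Fin
open import Data.Fin.Subset using (Subset; _∈_; _∉_; ∣_∣; ⁅_⁆; _∪_; ∁) renaming (⊥ to ∅)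
open import Data.Fin.Subset.Properties using (∣⊥∣≡0; ∣⁅x⁆∣≡1; x∈⁅x⁆; x∈p∪q⁺; x∈∁p⇒x∉p; ∣∁p∣≡n∸∣p∣)
open import Data.List using (List; []; _∷_; map; length)
open import Data.List.Properties using (length-map)
open import Data.List.Membership.Propositional using () renaming (_∈_ to _∈ₗ_)
open import Data.List.Relation.Unary.All using (All; []; _∷_)
import Data.List.Relation.Unary.All as All
import Data.List.Relation.Unary.All.Properties as All
open import Data.List.Relation.Unary.Any using (here; there)
open import Data.List.Relation.Unary.Unique.Propositional using (Unique; []; _∷_)
open import Data.List.Relation.Unary.Unique.Propositional.Properties using (Unique[x∷xs]⇒x∉xs)
import Data.List.Relation.Unary.Unique.Propositional.Properties as Unique
open import Data.Nat using (ℕ; zero; suc; _+_; _*_; _∸_; _≤_; _<_; z≤n; s≤s; s≤s⁻¹; z<s; pred; NonZero; >-nonZero)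
import Data.Nat as ℕ
open import Data.Nat.ListAction using (sum)
open import Data.Nat.Properties
open import Data.Nat.Tactic.RingSolver using (solve-∀)
open import Algebra.Properties.CommutativeSemigroup +-commutativeSemigroup using (interchange)
open import Data.Product using (Σ; ∃; ∃₂; _×_; _,_; proj₁; proj₂)
open import Data.Product.Function.NonDependent.Propositional using (_×-↔_)
import Data.Product.Properties as ×
open import Data.Sum using (_⊎_; inj₁; inj₂; [_,_]′; reduce)
open import Data.Sum.Function.Propositional using (_⊎-↔_)
import Data.Sum.Properties as ⊎
open import Data.Unit using (⊤; tt)
open import Data.Vec.Base using ([]; _∷_; here; there)
open import Function using (_∘_)
open import Function.Bundles using (Injection; Inverse; _↔_)
open import Function.Construct.Identity using (↔-id)
open import Function.Properties.Inverse using (↔⇒↣; ↔-sym; ↔-trans)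
open import Function.Related.TypeIsomorphisms using (Σ-distribʳ-⊎)
open import Relation.Binary.Definitions using (DecidableEquality; tri<; tri≈; tri>)
open import Relation.Binary.PropositionalEquality
open import Relation.Nullary using (¬_; Dec; does; yes; no; contradiction; _×-dec_; _⊎-dec_)
open import Relation.Nullary.Decidable using (dec-true; dec-false)

does⇒ : ∀ {P : Set} (p? : Dec P) → does p? ≡ true → P
does⇒ (yes p) _ = p

k∸m<m′ : ∀ {k m m′} → k < m + m′ → m ≤ k → k ∸ m < m′
k∸m<m′ {m = m} {m′} k< m≤k = subst (_ ∸ m <_) (m+n∸m≡n m m′) (∸-monoˡ-< k< m≤k)

monotone-by-steps : ∀ (f : ℕ → ℕ) → (∀ c → f c ≤ f (suc c)) → ∀ {c c′} → c ≤ c′ → f c ≤ f c′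
monotone-by-steps f step {c′ = zero}   z≤n = ≤-refl
monotone-by-steps f step {c′ = suc c′} c≤ with m≤n⇒m<n∨m≡n c≤
... | inj₁ c≤c′ = ≤-trans (monotone-by-steps f step (s≤s⁻¹ c≤c′)) (step c′)
... | inj₂ refl = ≤-refl

interval-spread : ∀ (P : ℕ → Set) {m} → (∀ {k} → suc k < m → P k → P (suc k)) →
                  (∀ {k} → suc k < m → P (suc k) → P k) →
                  ∀ {k₀} → k₀ < m → P k₀ → ∀ {k} → k < m → P k
interval-spread P {m} up down {k₀} k₀<m Pk₀ = everywhere
  where
  at-0 : ∀ {k} → k < m → P k → P 0
  at-0 {zero}  _   P0  = P0
  at-0 {suc k} k<m Pk = at-0 (<⇒≤ k<m) (down k<m Pk)
  everywhere : ∀ {k} → k < m → P k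
  everywhere {zero}  _   = at-0 k₀<m Pk₀
  everywhere {suc k} k<m = up k<m (everywhere (<⇒≤ k<m))

InjectiveBelow : {X : Set} → ℕ → (ℕ → X) → Set
InjectiveBelow m f = ∀ {k k′} → k < m → k′ < m → f k ≡ f k′ → k ≡ k′

module _ {X : Set} where

  infixr 5 _++[_]_

  _++[_]_ : (ℕ → X) → ℕ → (ℕ → X) → ℕ → X
  (p ++[ m ] q) k with k <? m
  ... | yes _ = p k
  ... | no _  = q (k ∸ m)

  module _ (p q : ℕ → X) {m : ℕ} where

    ++-left : ∀ {k} → k < m → (p ++[ m ] q) k ≡ p k
    ++-left {k} k<m with k <? m
    ... | yes _   = refl
    ... | no k≮m = contradiction k<m k≮m

    ++-right : ∀ {k} → m ≤ k → (p ++[ m ] q) k ≡ q (k ∸ m)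
    ++-right {k} m≤k with k <? m
    ... | yes k<m = contradiction m≤k (<⇒≱ k<m)
    ... | no _    = refl

    ++-all : ∀ (P : X → Set) {m′} → (∀ {k} → k < m → P (p k)) → (∀ {k} → k < m′ → P (q k)) →
             ∀ {k} → k < m + m′ → P ((p ++[ m ] q) k)
    ++-all P Pp Pq {k} k< with k <? m
    ... | yes k<m = Pp k<m
    ... | no k≮m  = Pq (k∸m<m′ k< (≮⇒≥ k≮m))

    ++-chain : ∀ (R : X → X → Set) {m′} → (∀ {k} → k < m → R (p k) (p (suc k))) → p m ≡ q 0 →
               (∀ {k} → k < m′ → R (q k) (q (suc k))) →
               ∀ {k} → k < m + m′ → R ((p ++[ m ] q) k) ((p ++[ m ] q) (suc k))
    ++-chain R Rp pm≡q0 Rq {k} k< with m ≤? suc k | m ≤? k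
    ... | no m≰1+k | _        = subst₂ R (sym (++-left k<m)) (sym (++-left (≰⇒> m≰1+k))) (Rp k<m)
      where
      k<m : k < m
      k<m = ≤-trans (n≤1+n (suc k)) (≰⇒> m≰1+k)
    ... | yes m≤1+k | no m≰k = subst₂ R (sym (++-left (≰⇒> m≰k))) (sym junction) (Rp (≰⇒> m≰k))
      where
      1+k≡m : suc k ≡ m
      1+k≡m = ≤-antisym (≰⇒> m≰k) m≤1+k
      junction : (p ++[ m ] q) (suc k) ≡ p (suc k)
      junction = begin
        (p ++[ m ] q) (suc k) ≡⟨ ++-right m≤1+k ⟩
        q (suc k ∸ m)         ≡⟨ cong q (m≤n⇒m∸n≡0 (≤-reflexive 1+k≡m)) ⟩
        q 0                   ≡⟨ sym pm≡q0 ⟩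
        p m                   ≡⟨ cong p (sym 1+k≡m) ⟩
        p (suc k)             ∎
        where open ≡-Reasoning
    ... | _         | yes m≤k =
      subst₂ R (sym (++-right m≤k)) (sym (trans (++-right (m≤n⇒m≤1+n m≤k)) (cong q (+-∸-assoc 1 m≤k))))
        (Rq (k∸m<m′ k< m≤k))

    ++-injective : ∀ {m′} → InjectiveBelow m p → InjectiveBelow m′ q →
                   (∀ {k k′} → k < m → k′ < m′ → p k ≢ q k′) → InjectiveBelow (m + m′) (p ++[ m ] q)
    ++-injective inj-p inj-q disjoint {k} {k′} k< k′< e with m ≤? k | m ≤? k′
    ... | no m≰k | no m≰k′ =
      inj-p (≰⇒> m≰k) (≰⇒> m≰k′) (trans (sym (++-left (≰⇒> m≰k))) (trans e (++-left (≰⇒> m≰k′))))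
    ... | no m≰k | yes m≤k′ = contradiction (trans (sym (++-left (≰⇒> m≰k))) (trans e (++-right m≤k′)))
                                 (disjoint (≰⇒> m≰k) (k∸m<m′ k′< m≤k′))
    ... | yes m≤k | no m≰k′ = contradiction (trans (sym (++-left (≰⇒> m≰k′))) (trans (sym e) (++-right m≤k)))
                                 (disjoint (≰⇒> m≰k′) (k∸m<m′ k< m≤k))
    ... | yes m≤k | yes m≤k′ = begin
      k               ≡⟨ sym (m+[n∸m]≡n m≤k) ⟩
      m + (k ∸ m)     ≡⟨ cong (m +_) (inj-q (k∸m<m′ k< m≤k) (k∸m<m′ k′< m≤k′)
                                        (trans (sym (++-right m≤k)) (trans e (++-right m≤k′)))) ⟩
      m + (k′ ∸ m)    ≡⟨ m+[n∸m]≡n m≤k′ ⟩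
      k′              ∎
      where open ≡-Reasoning

∣p∪q∣≤∣p∣+∣q∣ : ∀ {n} (p q : Subset n) → ∣ p ∪ q ∣ ≤ ∣ p ∣ + ∣ q ∣
∣p∪q∣≤∣p∣+∣q∣ []          []          = z≤n
∣p∪q∣≤∣p∣+∣q∣ (true ∷ p)  (true ∷ q)  =
  s≤s (≤-trans (∣p∪q∣≤∣p∣+∣q∣ p q) (+-monoʳ-≤ ∣ p ∣ (n≤1+n ∣ q ∣)))
∣p∪q∣≤∣p∣+∣q∣ (true ∷ p)  (false ∷ q) = s≤s (∣p∪q∣≤∣p∣+∣q∣ p q)
∣p∪q∣≤∣p∣+∣q∣ (false ∷ p) (true ∷ q)  =
  subst (suc ∣ p ∪ q ∣ ≤_) (sym (+-suc ∣ p ∣ ∣ q ∣)) (s≤s (∣p∪q∣≤∣p∣+∣q∣ p q))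
∣p∪q∣≤∣p∣+∣q∣ (false ∷ p) (false ∷ q) = ∣p∪q∣≤∣p∣+∣q∣ p q

image : ∀ {m n} → (Fin m → Fin n) → Subset m → Subset n
image f []          = ∅
image f (true ∷ p)  = ⁅ f zero ⁆ ∪ image (f ∘ suc) p
image f (false ∷ p) = image (f ∘ suc) p

∣image∣≤∣p∣ : ∀ {m n} (f : Fin m → Fin n) p → ∣ image f p ∣ ≤ ∣ p ∣
∣image∣≤∣p∣ {n = n} f [] = ≤-reflexive (∣⊥∣≡0 n)
∣image∣≤∣p∣ f (true ∷ p) = ≤-trans (∣p∪q∣≤∣p∣+∣q∣ ⁅ f zero ⁆ (image (f ∘ suc) p))
  (subst (λ k → k + ∣ image (f ∘ suc) p ∣ ≤ suc ∣ p ∣) (sym (∣⁅x⁆∣≡1 (f zero)))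
    (s≤s (∣image∣≤∣p∣ (f ∘ suc) p)))
∣image∣≤∣p∣ f (false ∷ p) = ∣image∣≤∣p∣ (f ∘ suc) p

∈image : ∀ {m n} (f : Fin m → Fin n) p {x} → x ∈ p → f x ∈ image f p
∈image f (true ∷ p)  here       = x∈p∪q⁺ (inj₁ (x∈⁅x⁆ (f zero)))
∈image f (true ∷ p)  (there x∈) = x∈p∪q⁺ (inj₂ (∈image (f ∘ suc) p x∈))
∈image f (false ∷ p) (there x∈) = ∈image (f ∘ suc) p x∈

elements : ∀ {n} → Subset n → List (Fin n)
elements []          = []
elements (true ∷ p)  = zero ∷ map suc (elements p)
elements (false ∷ p) = map suc (elements p)

length-elements : ∀ {n} (p : Subset n) → length (elements p) ≡ ∣ p ∣
length-elements []          = refl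
length-elements (true ∷ p)  = cong suc (trans (length-map suc (elements p)) (length-elements p))
length-elements (false ∷ p) = trans (length-map suc (elements p)) (length-elements p)

elements-unique : ∀ {n} (p : Subset n) → Unique (elements p)
elements-unique []          = []
elements-unique (true ∷ p)  =
  All.map⁺ (All.universal (λ _ ()) (elements p)) ∷ Unique.map⁺ Fin.suc-injective (elements-unique p)
elements-unique (false ∷ p) = Unique.map⁺ Fin.suc-injective (elements-unique p)

elements-∈ : ∀ {n} (p : Subset n) → All (_∈ p) (elements p)
elements-∈ []          = []
elements-∈ (true ∷ p)  = here ∷ All.map⁺ (All.map there (elements-∈ p))
elements-∈ (false ∷ p) = All.map⁺ (All.map there (elements-∈ p))

-- Cycles as cyclic walks

Visits : {X : Set} → ℕ → (ℕ → X) → X → Set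
Visits ℓ f x = ∃ λ k → k < ℓ × f k ≡ x

record CyclicWalk (G : Graph) (ℓ : ℕ) (f : ℕ → Fin (n G)) : Set where
  field
    3≤ℓ       : 3 ≤ ℓ
    adjacent  : ∀ {k} → k < ℓ → E G (f k) (f (suc k)) ≡ true
    returns   : f ℓ ≡ f 0
    injective : InjectiveBelow ℓ f

module _ {G : Graph} (C : Cycle G) where

  vertexAt : ℕ → Fin (n G)
  vertexAt k with k <? suc (len C)
  ... | yes k≤ℓ = v C (fromℕ< k≤ℓ)
  ... | no _    = v C zero  -- junk: positions beyond len C are never used

  vertexAt-toℕ : ∀ i → vertexAt (toℕ i) ≡ v C i
  vertexAt-toℕ i with toℕ i <? suc (len C)
  ... | yes i≤ℓ = cong (v C) (fromℕ<-toℕ i i≤ℓ)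
  ... | no i≰ℓ  = contradiction (toℕ<n i) i≰ℓ

  vertexAt-inject₁ : ∀ i → vertexAt (toℕ i) ≡ v C (inject₁ i)
  vertexAt-inject₁ i = trans (cong vertexAt (sym (toℕ-inject₁ i))) (vertexAt-toℕ (inject₁ i))

  cycle⇒walk : CyclicWalk G (len C) vertexAt
  cycle⇒walk = record
    { 3≤ℓ       = len≥3 C
    ; adjacent  = adjacent
    ; returns   = trans (cong vertexAt (sym (toℕ-fromℕ (len C))))
                    (trans (vertexAt-toℕ (fromℕ (len C))) (trans (sym (closed C)) (sym (vertexAt-toℕ zero))))
    ; injective = injective
    }
    where
    at : ∀ {k} (k<ℓ : k < len C) → vertexAt k ≡ v C (inject₁ (fromℕ< k<ℓ))
    at k<ℓ = trans (cong vertexAt (sym (toℕ-fromℕ< k<ℓ))) (vertexAt-inject₁ (fromℕ< k<ℓ))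
    at-suc : ∀ {k} (k<ℓ : k < len C) → vertexAt (suc k) ≡ v C (suc (fromℕ< k<ℓ))
    at-suc k<ℓ = trans (cong (vertexAt ∘ suc) (sym (toℕ-fromℕ< k<ℓ))) (vertexAt-toℕ (suc (fromℕ< k<ℓ)))
    adjacent : ∀ {k} → k < len C → E G (vertexAt k) (vertexAt (suc k)) ≡ true
    adjacent k<ℓ = subst₂ (λ x y → E G x y ≡ true) (sym (at k<ℓ)) (sym (at-suc k<ℓ)) (adj C (fromℕ< k<ℓ))
    injective : InjectiveBelow (len C) vertexAt
    injective k<ℓ k′<ℓ e = begin
      _                     ≡⟨ sym (toℕ-fromℕ< k<ℓ) ⟩
      toℕ (fromℕ< k<ℓ)     ≡⟨ cong toℕ (inj C _ _ (trans (sym (at k<ℓ)) (trans e (at k′<ℓ)))) ⟩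
      toℕ (fromℕ< k′<ℓ)    ≡⟨ toℕ-fromℕ< k′<ℓ ⟩
      _                     ∎
      where open ≡-Reasoning

module _ {G : Graph} {ℓ : ℕ} {f : ℕ → Fin (n G)} (w : CyclicWalk G ℓ f) where
  open CyclicWalk w

  walk⇒cycle : Cycle G
  walk⇒cycle = record
    { len    = ℓ
    ; len≥3  = 3≤ℓ
    ; v      = λ i → f (toℕ i)
    ; closed = sym (trans (cong f (toℕ-fromℕ ℓ)) returns)
    ; adj    = λ i → subst (λ k → E G (f k) (f (suc (toℕ i))) ≡ true) (sym (toℕ-inject₁ i))
                         (adjacent (toℕ<n i))
    ; inj    = λ i j e → inject₁-injective (toℕ-injective (injective (bound i) (bound j) e))
    }
    where
    bound : ∀ (i : Fin ℓ) → toℕ (inject₁ i) < ℓ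
    bound i = subst (_< ℓ) (sym (toℕ-inject₁ i)) (toℕ<n i)

  walk⇒cycle-visits : ∀ {x} → OnCycle walk⇒cycle x → Visits ℓ f x
  walk⇒cycle-visits (i , e) = toℕ i , toℕ<n i , trans (cong f (sym (toℕ-inject₁ i))) e

  private
    0<ℓ : 0 < ℓ
    0<ℓ = ≤-trans (s≤s z≤n) 3≤ℓ

    ℓ≢2 : ℓ ≢ 2
    ℓ≢2 refl = contradiction 3≤ℓ λ { (s≤s (s≤s ())) }

    reverse-edge : ∀ {x y} → E G x y ≡ true → E G y x ≡ true
    reverse-edge {x} {y} e = trans (E-sym G y x) e

  visits≤ : ∀ {k} → k ≤ ℓ → Visits ℓ f (f k)
  visits≤ {k} k≤ℓ with m≤n⇒m<n∨m≡n k≤ℓ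
  ... | inj₁ k<ℓ = k , k<ℓ , refl
  ... | inj₂ refl = 0 , 0<ℓ , sym returns

  two-neighbours : ∀ {k} → k < ℓ → ∃₂ λ i j → i ≤ ℓ × j ≤ ℓ × f i ≢ f j ×
                   E G (f k) (f i) ≡ true × E G (f k) (f j) ≡ true
  two-neighbours {zero} _ =
    1 , pred ℓ , <⇒≤ 1<ℓ , pred[n]≤n , 1≢pred , adjacent 0<ℓ , reverse-edge last-edge
    where
    instance
      ℓ-nonZero : NonZero ℓ
      ℓ-nonZero = >-nonZero 0<ℓ
    1<ℓ : 1 < ℓ
    1<ℓ = ≤-trans (s≤s (s≤s z≤n)) 3≤ℓ
    last-edge : E G (f (pred ℓ)) (f 0) ≡ true
    last-edge = subst (λ y → E G (f (pred ℓ)) y ≡ true) (trans (cong f (suc-pred ℓ)) returns)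
                  (adjacent (≤-reflexive (suc-pred ℓ)))
    1≢pred : f 1 ≢ f (pred ℓ)
    1≢pred e = ℓ≢2 (trans (sym (suc-pred ℓ)) (cong suc (sym (injective 1<ℓ (≤-reflexive (suc-pred ℓ)) e))))
  two-neighbours {suc k} 1+k<ℓ =
    k , suc (suc k) , <⇒≤ (<⇒≤ 1+k<ℓ) , 1+k<ℓ , distinct , reverse-edge (adjacent (<⇒≤ 1+k<ℓ)) , adjacent 1+k<ℓ
    where
    distinct : f k ≢ f (suc (suc k))
    distinct e with m≤n⇒m<n∨m≡n 1+k<ℓ
    ... | inj₁ 2+k<ℓ = <⇒≢ (<-trans (n<1+n k) (n<1+n (suc k))) (injective (<⇒≤ 1+k<ℓ) 2+k<ℓ e)
    ... | inj₂ refl  = ℓ≢2 (cong (λ k → suc (suc k)) (injective (<⇒≤ 1+k<ℓ) 0<ℓ (trans e returns)))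

  neighbours-visited : ∀ {x a b} → Visits ℓ f x → (∀ y → E G x y ≡ true → y ≡ a ⊎ y ≡ b) →
                       Visits ℓ f a × Visits ℓ f b
  neighbours-visited (k , k<ℓ , refl) only-a-b with two-neighbours k<ℓ
  ... | i , j , i≤ℓ , j≤ℓ , fi≢fj , ei , ej with only-a-b (f i) ei | only-a-b (f j) ej
  ...   | inj₁ refl | inj₂ refl = visits≤ i≤ℓ , visits≤ j≤ℓ
  ...   | inj₂ refl | inj₁ refl = visits≤ j≤ℓ , visits≤ i≤ℓ
  ...   | inj₁ refl | inj₁ e    = contradiction (sym e) fi≢fj
  ...   | inj₂ refl | inj₂ e    = contradiction (sym e) fi≢fj

  interior-visited : ∀ (p : ℕ → Fin (n G)) {m} →
                     (∀ {k} → k < m → ∀ y → E G (p (suc k)) y ≡ true → y ≡ p k ⊎ y ≡ p (suc (suc k))) →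
                     ∀ {k₀} → k₀ < m → Visits ℓ f (p (suc k₀)) → ∀ {k} → k < m → Visits ℓ f (p (suc k))
  interior-visited p degree-two =
    interval-spread (λ k → Visits ℓ f (p (suc k)))
      (λ 1+k<m visited → proj₂ (neighbours-visited visited (degree-two (<⇒≤ 1+k<m))))
      (λ 1+k<m visited → proj₁ (neighbours-visited visited (degree-two 1+k<m)))

  visits⇒≤ : ∀ (g : ℕ → Fin (n G)) {m} → InjectiveBelow m g → (∀ {k} → k < m → Visits ℓ f (g k)) → m ≤ ℓ
  visits⇒≤ g {m} g-injective visited = injective⇒≤ {f = position} position-injective
    where
    position : Fin m → Fin ℓ
    position j = fromℕ< (proj₁ (proj₂ (visited (toℕ<n j))))
    position-injective : ∀ {j j′} → position j ≡ position j′ → j ≡ j′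
    position-injective {j} {j′} e = toℕ-injective (g-injective (toℕ<n j) (toℕ<n j′) (begin
      g (toℕ j)     ≡⟨ sym (proj₂ (proj₂ (visited (toℕ<n j)))) ⟩
      f _           ≡⟨ cong f (trans (sym (toℕ-fromℕ< _)) (trans (cong toℕ e) (toℕ-fromℕ< _))) ⟩
      f _           ≡⟨ proj₂ (proj₂ (visited (toℕ<n j′))) ⟩
      g (toℕ j′)    ∎))
      where open ≡-Reasoning

module _ {G : Graph} where

  len≤n : (C : Cycle G) → len C ≤ n G
  len≤n C = injective⇒≤ {f = v C ∘ inject₁} (inj C _ _)

  disjoint⇒len+len≤n : (C D : Cycle G) → Disjoint C D → len C + len D ≤ n G
  disjoint⇒len+len≤n C D disjoint = injective⇒≤ {f = vertex ∘ splitAt (len C)} injective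
    where
    vertex : Fin (len C) ⊎ Fin (len D) → Fin (n G)
    vertex = [ v C ∘ inject₁ , v D ∘ inject₁ ]′
    vertex-injective : ∀ {a b} → vertex a ≡ vertex b → a ≡ b
    vertex-injective {inj₁ i} {inj₁ j} e = cong inj₁ (inj C i j e)
    vertex-injective {inj₂ i} {inj₂ j} e = cong inj₂ (inj D i j e)
    vertex-injective {inj₁ i} {inj₂ j} e = contradiction (j , sym e) (disjoint _ (i , refl))
    vertex-injective {inj₂ i} {inj₁ j} e = contradiction (i , refl) (disjoint _ (j , sym e))
    injective : ∀ {a b} → vertex (splitAt (len C) a) ≡ vertex (splitAt (len C) b) → a ≡ b
    injective = Injection.injective (↔⇒↣ +↔⊎) ∘ vertex-injective

-- Subdivided digraphs

-- Each arc a of the digraph (B, A) becomes a path through the new vertices sub a 0, …, sub a (size a);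
-- path a lists it from index 0 (= tail a) to index size a + 2 (= head a).
module Subdivision {B A : Set} (_≟ᴮ_ : DecidableEquality B) (_≟ᴬ_ : DecidableEquality A)
                   (tail head : A → B) (size : A → ℕ) where

  Vertex : Set
  Vertex = B ⊎ Σ A (λ a → Fin (suc (size a)))

  pattern branch b = inj₁ b
  pattern sub a j  = inj₂ (a , j)

  Arc : Vertex → Vertex → Set
  Arc (branch b) (sub a j)   = tail a ≡ b × toℕ j ≡ 0
  Arc (sub a j)  (sub a′ j′) = a ≡ a′ × suc (toℕ j) ≡ toℕ j′
  Arc (sub a j)  (branch b)  = head a ≡ b × toℕ j ≡ size a
  Arc (branch _) (branch _)  = ⊥

  arc? : ∀ x y → Dec (Arc x y)
  arc? (branch b) (sub a j)   = tail a ≟ᴮ b ×-dec toℕ j ℕ.≟ 0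
  arc? (sub a j)  (sub a′ j′) = a ≟ᴬ a′ ×-dec suc (toℕ j) ℕ.≟ toℕ j′
  arc? (sub a j)  (branch b)  = head a ≟ᴮ b ×-dec toℕ j ℕ.≟ size a
  arc? (branch _) (branch _)  = no λ ()

  ¬arc-loop : ∀ x → ¬ Arc x x
  ¬arc-loop (sub a j) (_ , 1+j≡j) = 1+n≢n 1+j≡j

  Adjacent : Vertex → Vertex → Set
  Adjacent x y = Arc x y ⊎ Arc y x

  adjacent? : ∀ x y → Dec (Adjacent x y)
  adjacent? x y = arc? x y ⊎-dec arc? y x

  path : A → ℕ → Vertex
  path a zero = branch (tail a)
  path a (suc k) with k <? suc (size a)
  ... | yes k≤size = sub a (fromℕ< k≤size)
  ... | no _       = branch (head a)

  path-suc : ∀ a {k} (k≤size : k < suc (size a)) → path a (suc k) ≡ sub a (fromℕ< k≤size)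
  path-suc a {k} k≤size with k <? suc (size a)
  ... | yes _     = refl
  ... | no k≰size = contradiction k≤size k≰size

  path-sub : ∀ a j → path a (suc (toℕ j)) ≡ sub a j
  path-sub a j = trans (path-suc a (toℕ<n j)) (cong (λ j → sub a j) (fromℕ<-toℕ j (toℕ<n j)))

  path-head : ∀ a → path a (suc (suc (size a))) ≡ branch (head a)
  path-head a with suc (size a) <? suc (size a)
  ... | yes size<size = contradiction size<size (<-irrefl refl)
  ... | no _          = refl

  path-arc : ∀ a {k} → k < suc (suc (size a)) → Arc (path a k) (path a (suc k))
  path-arc a {zero} _ = subst (Arc (branch (tail a))) (sym (path-suc a 0≤size)) (refl , toℕ-fromℕ< 0≤size)
    where
    0≤size : 0 < suc (size a)
    0≤size = s≤s z≤n
  path-arc a {suc k} (s≤s k≤size) with m≤n⇒m<n∨m≡n k≤size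
  ... | inj₁ k<size = subst₂ Arc (sym (path-suc a k≤size)) (sym (path-suc a k<size))
                        (refl , trans (cong suc (toℕ-fromℕ< k≤size)) (sym (toℕ-fromℕ< k<size)))
  ... | inj₂ refl   = subst₂ Arc (sym (path-suc a k≤size)) (sym (path-head a)) (refl , toℕ-fromℕ< k≤size)

  sub-neighbours : ∀ a j y → Adjacent (sub a j) y → y ≡ path a (toℕ j) ⊎ y ≡ path a (suc (suc (toℕ j)))
  sub-neighbours a j (sub _ j′) (inj₁ (refl , e)) =
    inj₂ (trans (sym (path-sub a j′)) (cong (λ k → path a (suc k)) (sym e)))
  sub-neighbours a j (branch _) (inj₁ (refl , e)) =
    inj₂ (trans (sym (path-head a)) (cong (λ k → path a (suc (suc k))) (sym e)))
  sub-neighbours a j (sub _ j′) (inj₂ (refl , e)) = inj₁ (trans (sym (path-sub a j′)) (cong (path a) e))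
  sub-neighbours a j (branch _) (inj₂ (refl , e)) = inj₁ (cong (path a) (sym e))

  position : Vertex → ℕ
  position (branch _) = 0
  position (sub _ j)  = suc (toℕ j)

  position-path : ∀ a {k} → k < suc (suc (size a)) → position (path a k) ≡ k
  position-path a {zero}  _              = refl
  position-path a {suc k} (s≤s k≤size) = trans (cong position (path-suc a k≤size)) (cong suc (toℕ-fromℕ< k≤size))

  path-injective : ∀ a → InjectiveBelow (suc (suc (size a))) (path a)
  path-injective a k< k′< e = trans (sym (position-path a k<)) (trans (cong position e) (position-path a k′<))

  owner : Vertex → B
  owner (branch b) = b
  owner (sub a _)  = tail a

  owner-path : ∀ a {k} → k < suc (suc (size a)) → owner (path a k) ≡ tail a
  owner-path a {zero}  _              = refl
  owner-path a {suc k} (s≤s k≤size) = cong owner (path-suc a k≤size)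

  entry : B → List A → B
  entry z []      = z
  entry z (a ∷ _) = tail a

  WalkTo : B → List A → Set
  WalkTo z []       = ⊤
  WalkTo z (a ∷ as) = head a ≡ entry z as × WalkTo z as

  tour : B → List A → ℕ → Vertex
  tour z []       = λ _ → branch z
  tour z (a ∷ as) = path a ++[ suc (suc (size a)) ] tour z as

  tourLength : List A → ℕ
  tourLength as = sum (map (λ a → suc (suc (size a))) as)

  tour-start : ∀ z as → tour z as 0 ≡ branch (entry z as)
  tour-start z []      = refl
  tour-start z (a ∷ as) = ++-left (path a) (tour z as) {suc (suc (size a))} z<s

  tour-end : ∀ z as → tour z as (tourLength as) ≡ branch z
  tour-end z []       = refl
  tour-end z (a ∷ as) = begin
    tour z (a ∷ as) (m + tourLength as) ≡⟨ ++-right (path a) (tour z as) (m≤m+n m (tourLength as)) ⟩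
    tour z as (m + tourLength as ∸ m)   ≡⟨ cong (tour z as) (m+n∸m≡n m (tourLength as)) ⟩
    tour z as (tourLength as)           ≡⟨ tour-end z as ⟩
    branch z                            ∎
    where
    m : ℕ
    m = suc (suc (size a))
    open ≡-Reasoning

  tour-arc : ∀ {z} as → WalkTo z as → ∀ {k} → k < tourLength as → Arc (tour z as k) (tour z as (suc k))
  tour-arc {z} (a ∷ as) (head≡entry , walk) =
    ++-chain (path a) (tour z as) Arc (path-arc a) junction (tour-arc as walk)
    where
    junction : path a (suc (suc (size a))) ≡ tour z as 0
    junction = trans (path-head a) (trans (cong branch head≡entry) (sym (tour-start z as)))

  tour-owner : ∀ z as {k} → k < tourLength as → owner (tour z as k) ∈ₗ map tail as
  tour-owner z (a ∷ as) = ++-all (path a) (tour z as) (λ x → owner x ∈ₗ map tail (a ∷ as))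
                            (λ k< → here (owner-path a k<)) (λ k< → there (tour-owner z as k<))

  tour-injective : ∀ z as → Unique (map tail as) → InjectiveBelow (tourLength as) (tour z as)
  tour-injective z (a ∷ as) unique@(_ ∷ unique-as) =
    ++-injective (path a) (tour z as) (path-injective a) (tour-injective z as unique-as) disjoint
    where
    disjoint : ∀ {k k′} → k < suc (suc (size a)) → k′ < tourLength as → path a k ≢ tour z as k′
    disjoint k< k′< e = Unique[x∷xs]⇒x∉xs unique
      (subst (_∈ₗ map tail as) (trans (cong owner (sym e)) (owner-path a k<)) (tour-owner z as k′<))

  module Encoded {N : ℕ} (code : Fin N ↔ Vertex) where
    open Inverse code using (to; from; strictlyInverseˡ; strictlyInverseʳ)

    graph : Graph
    graph = record
      { n     = N
      ; E     = λ x y → does (adjacent? (to x) (to y))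
      ; E-sym = λ x y → ∨-comm (does (arc? (to x) (to y))) (does (arc? (to y) (to x)))
      ; E-irr = λ x → dec-false (adjacent? (to x) (to x)) [ ¬arc-loop (to x) , ¬arc-loop (to x) ]′
      }

    edge⇒adjacent : ∀ {x y} → E graph x y ≡ true → Adjacent (to x) (to y)
    edge⇒adjacent {x} {y} e with arc? (to x) (to y) | arc? (to y) (to x)
    edge⇒adjacent e  | yes arc | _       = inj₁ arc
    edge⇒adjacent e  | no _    | yes arc = inj₂ arc
    edge⇒adjacent () | no _    | no _

    adjacent⇒edge : ∀ {x y} → Adjacent x y → E graph (from x) (from y) ≡ true
    adjacent⇒edge {x} {y} adjacent = dec-true (adjacent? (to (from x)) (to (from y)))
      (subst₂ Adjacent (sym (strictlyInverseˡ x)) (sym (strictlyInverseˡ y)) adjacent)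

    from-injective : ∀ {x y} → from x ≡ from y → x ≡ y
    from-injective = Injection.injective (↔⇒↣ (↔-sym code))

    to≡⇒≡from : ∀ {x y} → to x ≡ y → x ≡ from y
    to≡⇒≡from {x} e = trans (sym (strictlyInverseʳ x)) (cong from e)

    sub-visited⇒size<ℓ : ∀ {ℓ f} → CyclicWalk graph ℓ f →
                         ∀ {a j} → Visits ℓ f (from (sub a j)) → size a < ℓ
    sub-visited⇒size<ℓ {ℓ} {f} w {a} {j} visited =
      visits⇒≤ w (from ∘ path a ∘ suc) interior-injective
        (interior-visited w (from ∘ path a) degree-two (toℕ<n j)
          (subst (Visits ℓ f ∘ from) (sym (path-sub a j)) visited))
      where
      interior-injective : InjectiveBelow (suc (size a)) (from ∘ path a ∘ suc)
      interior-injective k< k′< e = suc-injective (path-injective a (s≤s k<) (s≤s k′<) (from-injective e))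
      degree-two : ∀ {k} → k < suc (size a) → ∀ y → E graph (from (path a (suc k))) y ≡ true →
                   y ≡ from (path a k) ⊎ y ≡ from (path a (suc (suc k)))
      degree-two {k} k< y e
        with sub-neighbours a (fromℕ< k<) (to y)
               (subst (λ x → Adjacent x (to y)) (trans (strictlyInverseˡ _) (path-suc a k<)) (edge⇒adjacent e))
      ... | inj₁ e′ = inj₁ (to≡⇒≡from (trans e′ (cong (path a) (toℕ-fromℕ< k<))))
      ... | inj₂ e′ = inj₂ (to≡⇒≡from (trans e′ (cong (λ k → path a (suc (suc k))) (toℕ-fromℕ< k<))))

    module _ {s} (s≤size : ∀ a → s ≤ size a) (C : Cycle graph) where
      private
        w : CyclicWalk graph (len C) (vertexAt C)
        w = cycle⇒walk C
        0<ℓ : 0 < len C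
        0<ℓ = ≤-trans (s≤s z≤n) (len≥3 C)
        1<ℓ : 1 < len C
        1<ℓ = ≤-trans (s≤s (s≤s z≤n)) (len≥3 C)
        long : ∀ {a j} → Visits (len C) (vertexAt C) (from (sub a j)) → s < len C
        long {a} visited = ≤-trans (s≤s (s≤size a)) (sub-visited⇒size<ℓ w visited)

      girth : s < len C
      girth with to (vertexAt C 0) in e₀ | to (vertexAt C 1) in e₁
      ... | sub a _  | _        = long (0 , 0<ℓ , to≡⇒≡from e₀)
      ... | branch _ | sub a _  = long (1 , 1<ℓ , to≡⇒≡from e₁)
      ... | branch _ | branch _ =
        contradiction (subst₂ Adjacent e₀ e₁ (edge⇒adjacent (CyclicWalk.adjacent w 0<ℓ))) λ { (inj₁ ()) ; (inj₂ ()) }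

    tour-cycle : ∀ a as → WalkTo (tail a) (a ∷ as) → Unique (map tail (a ∷ as)) → 3 ≤ tourLength (a ∷ as) →
                 Σ (Cycle graph) λ C → len C ≡ tourLength (a ∷ as) ×
                                       (∀ {x} → OnCycle C x → owner (to x) ∈ₗ map tail (a ∷ as))
    tour-cycle a as walk unique 3≤ = walk⇒cycle w , refl , owners
      where
      t : ℕ → Vertex
      t = tour (tail a) (a ∷ as)
      w : CyclicWalk graph (tourLength (a ∷ as)) (from ∘ t)
      w = record
        { 3≤ℓ       = 3≤
        ; adjacent  = λ k< → adjacent⇒edge (inj₁ (tour-arc (a ∷ as) walk k<))
        ; returns   = cong from (trans (tour-end (tail a) (a ∷ as)) (sym (tour-start (tail a) (a ∷ as))))
        ; injective = λ k< k′< e → tour-injective (tail a) (a ∷ as) unique k< k′< (from-injective e)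
        }
      owners : ∀ {x} → OnCycle (walk⇒cycle w) x → owner (to x) ∈ₗ map tail (a ∷ as)
      owners on with walk⇒cycle-visits w on
      ... | k , k< , refl = subst (λ x → owner x ∈ₗ map tail (a ∷ as)) (sym (strictlyInverseˡ (t k)))
                              (tour-owner (tail a) (a ∷ as) k<)

-- The row digraph

module RowGraph (M R r : ℕ) where

  pattern start i  = inj₁ i
  pattern end i    = inj₂ i
  pattern spine i  = inj₁ i
  pattern link u w = inj₂ (u , w)

  Label : Set
  Label = Fin M ⊎ Fin M × Fin M

  source target : Label → Fin M ⊎ Fin M
  source (spine i)  = start i
  source (link u _) = end u
  target (spine i)  = end i
  target (link _ w) = start w

  size : Label → ℕ
  size (spine _)  = R
  size (link _ _) = r

  open Subdivision (⊎.≡-dec Fin._≟_ Fin._≟_) (⊎.≡-dec Fin._≟_ (×.≡-dec Fin._≟_ Fin._≟_))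
                   source target size public

  block : ℕ
  block = suc (suc R) + suc (suc r)

  order : ℕ
  order = (M + M) + (M * suc R + M * M * suc r)

  code : Fin order ↔ Vertex
  code = ↔-trans +↔⊎ (+↔⊎ ⊎-↔ ↔-trans +↔⊎
           (↔-trans (*↔× ⊎-↔ ↔-trans *↔× (*↔× ×-↔ ↔-id _)) (↔-sym Σ-distribʳ-⊎)))

  open Encoded code public

  r≤size : r ≤ R → ∀ a → r ≤ size a
  r≤size r≤R (spine _)  = r≤R
  r≤size r≤R (link _ _) = ≤-refl

  row : Fin M ⊎ Fin M → Fin M
  row = reduce

  rowOf : Fin order → Fin M
  rowOf x = row (owner (Inverse.to code x))

  nextRow : Fin M → List (Fin M) → Fin M
  nextRow z []      = z
  nextRow _ (s ∷ _) = s

  rowTour : Fin M → List (Fin M) → List Label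
  rowTour z []       = []
  rowTour z (s ∷ ss) = spine s ∷ link s (nextRow z ss) ∷ rowTour z ss

  rowTour-walk : ∀ z ss → WalkTo (start z) (rowTour z ss)
  rowTour-walk z []            = tt
  rowTour-walk z (s ∷ [])      = refl , refl , tt
  rowTour-walk z (s ∷ s′ ∷ ss) = refl , refl , rowTour-walk z (s′ ∷ ss)

  rowTour-rows : ∀ z ss → All (λ b → row b ∈ₗ ss) (map source (rowTour z ss))
  rowTour-rows z []       = []
  rowTour-rows z (s ∷ ss) = here refl ∷ here refl ∷ All.map there (rowTour-rows z ss)

  rowTour-unique : ∀ z ss → Unique ss → Unique (map source (rowTour z ss))
  rowTour-unique z []       []                   = []
  rowTour-unique z (s ∷ ss) unique@(_ ∷ unique-ss) =
    ((λ ()) ∷ fresh refl) ∷ fresh refl ∷ rowTour-unique z ss unique-ss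
    where
    fresh : ∀ {b} → row b ≡ s → All (b ≢_) (map source (rowTour z ss))
    fresh row-b≡s = All.map (λ row∈ss b≡ → Unique[x∷xs]⇒x∉xs unique
                                             (subst (_∈ₗ ss) (trans (cong row (sym b≡)) row-b≡s) row∈ss))
                      (rowTour-rows z ss)

  rowTour-length : ∀ z ss → tourLength (rowTour z ss) ≡ length ss * block
  rowTour-length z []       = refl
  rowTour-length z (s ∷ ss) =
    trans (sym (+-assoc (suc (suc R)) (suc (suc r)) _)) (cong (block +_) (rowTour-length z ss))

  3≤rowTour-length : ∀ z s ss → 3 ≤ tourLength (rowTour z (s ∷ ss))
  3≤rowTour-length z s ss = s≤s (s≤s (≤-trans (s≤s z≤n) (m≤n+m _ R)))

  cycle-through-rows : ∀ s ss → Unique (s ∷ ss) →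
                       Σ (Cycle graph) λ C → len C ≡ length (s ∷ ss) * block ×
                                             (∀ {x} → OnCycle C x → rowOf x ∈ₗ s ∷ ss)
  cycle-through-rows s ss unique
    with tour-cycle (spine s) (link s (nextRow s ss) ∷ rowTour s ss) (rowTour-walk s (s ∷ ss))
                    (rowTour-unique s (s ∷ ss) unique) (3≤rowTour-length s s ss)
  ... | C , len≡ , owners = C , trans len≡ (rowTour-length s (s ∷ ss)) ,
                            λ on → All.lookup (rowTour-rows s (s ∷ ss)) (owners on)

-- Windows

rows : ℕ → ℕ
rows c = suc (suc (c + c))

spineLength : ℕ → ℕ → ℕ
spineLength c r = rows c * rows c * suc r

module Gadget (c r : ℕ) = RowGraph (rows c) (spineLength c r) r

low : ℕ → ℕ
low zero    = 0
low (suc c) = suc (suc c) * suc (Gadget.order c (low c))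

high : ℕ → ℕ
high c = Gadget.order c (low c)

InWindow : ℕ → ℕ → Set
InWindow c l = low c < l × l ≤ high c

inWindow? : ∀ c l → Dec (InWindow c l)
inWindow? c l = low c <? l ×-dec l ≤? high c

r<spineLength : ∀ c r → r < spineLength c r
r<spineLength c r = m≤n*m (suc r) (rows c * rows c)

low<high : ∀ c → low c < high c
low<high c = ≤-trans (r<spineLength c (low c)) (≤-trans (m≤n+m R (M * suc R)) (m≤n+m _ (M + M)))
  where
  M R : ℕ
  M = rows c
  R = spineLength c (low c)

high<low : ∀ c → high c < low (suc c)
high<low c = m≤n*m (suc (high c)) (suc (suc c))

c≤low : ∀ c → c ≤ low c
c≤low zero    = z≤n
c≤low (suc c) = ≤-trans (n≤1+n (suc c)) (m≤m*n (suc (suc c)) (suc (high c)))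

low-mono : ∀ {c c′} → c ≤ c′ → low c ≤ low c′
low-mono = monotone-by-steps low (λ c → <⇒≤ (<-trans (low<high c) (high<low c)))

high-mono : ∀ {c c′} → c ≤ c′ → high c ≤ high c′
high-mono = monotone-by-steps high (λ c → <⇒≤ (<-trans (high<low c) (low<high (suc c))))

window-unique : ∀ {c c′ l} → InWindow c l → InWindow c′ l → c ≡ c′
window-unique {c} {c′} (low<l , l≤high) (low′<l , l≤high′) with <-cmp c c′
... | tri< c<c′ _ _ =
  contradiction (≤-<-trans l≤high (<-≤-trans (high<low c) (low-mono c<c′))) (<⇒≱ low′<l ∘ <⇒≤)
... | tri≈ _ c≡c′ _ = c≡c′
... | tri> _ _ c′<c =
  contradiction (≤-<-trans l≤high′ (<-≤-trans (high<low c′) (low-mono c′<c))) (<⇒≱ low<l ∘ <⇒≤)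

windowed : SubsetN → SubsetN
windowed L l with Fin.any? (λ (c : Fin l) → inWindow? (toℕ c) l)
... | yes (c , _) = does (high (toℕ c) <? l + l)
... | no _        = L l

windowed-in-window : ∀ L {c l} → InWindow c l → windowed L l ≡ does (high c <? l + l)
windowed-in-window L {c} {l} w with Fin.any? (λ (c : Fin l) → inWindow? (toℕ c) l)
... | yes (c′ , w′) = cong (λ c → does (high c <? l + l)) (window-unique {toℕ c′} {c} w′ w)
... | no none       = contradiction (fromℕ< c<l , subst (λ c → InWindow c l) (sym (toℕ-fromℕ< c<l)) w) none
  where
  c<l : c < l
  c<l = ≤-<-trans (c≤low c) (proj₁ w)

symDiff⇒window : ∀ L {l} → SymDiff L (windowed L) l ≡ true → ∃ λ c → InWindow c l
symDiff⇒window L {l} e with Fin.any? (λ (c : Fin l) → inWindow? (toℕ c) l)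
... | yes (c , w) = toℕ c , w
... | no _        = contradiction (trans (sym (xor-same (L l))) e) λ ()

count≤ : ∀ A m → count A m ≤ m
count≤ A zero = z≤n
count≤ A (suc m) with A (suc m)
... | true  = s≤s (count≤ A m)
... | false = m≤n⇒m≤1+n (count≤ A m)

count≤bound : ∀ A m {b} → (∀ {i} → i ≤ m → A i ≡ true → i ≤ b) → count A m ≤ b
count≤bound A zero    _       = z≤n
count≤bound A (suc m) bounded with A (suc m) in e
... | true  = ≤-trans (s≤s (count≤ A m)) (bounded ≤-refl e)
... | false = count≤bound A m (bounded ∘ m≤n⇒m≤1+n)

symDiff-sparse : ∀ L → LowerDensityZero (SymDiff L (windowed L))
symDiff-sparse L k N₀ = low (suc c) , N₀≤low , sparse
  where
  c : ℕ
  c = k + N₀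
  N₀≤low : N₀ ≤ low (suc c)
  N₀≤low = ≤-trans (m≤n+m N₀ k) (≤-trans (n≤1+n c) (c≤low (suc c)))
  below : ∀ {i} → i ≤ low (suc c) → SymDiff L (windowed L) i ≡ true → i ≤ high c
  below i≤low e with symDiff⇒window L e
  ... | d , low<i , i≤high with d ≤? c
  ...   | yes d≤c = ≤-trans i≤high (high-mono d≤c)
  ...   | no d≰c  = contradiction (<-≤-trans low<i i≤low) (≤⇒≯ (low-mono (≰⇒> d≰c)))
  sparse : suc k * count (SymDiff L (windowed L)) (low (suc c)) < low (suc c)
  sparse = begin-strict
    suc k * count (SymDiff L (windowed L)) (low (suc c)) ≤⟨ *-monoʳ-≤ (suc k) (count≤bound _ _ below) ⟩
    suc k * high c                                   <⟨ *-monoʳ-< (suc k) (n<1+n (high c)) ⟩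
    suc k * suc (high c)                             ≤⟨ *-monoˡ-≤ (suc (high c)) (s≤s (m≤n⇒m≤1+n (m≤m+n k N₀))) ⟩
    suc (suc c) * suc (high c)                       ∎
    where open ≤-Reasoning

-- The gadget graphs

-- For R = M * M * suc r the first summand is the order of RowGraph M R r.
order-bound : ∀ M R r → (M + M) + (M * suc R + R) + suc (R + M * r + M + r + r + 7) ≡
                        suc (suc M) * (suc (suc R) + suc (suc r))
order-bound = solve-∀

module _ (c : ℕ) where
  open Gadget c (low c)

  cycle-in-window : (C : Cycle graph) → InWindow c (len C)
  cycle-in-window C = girth (r≤size (<⇒≤ (r<spineLength c (low c)))) C , len≤n C

  high<twice-tour : ∀ {q} → suc (suc c) ≤ q → high c < q * block + q * block
  high<twice-tour {q} 2+c≤q = begin-strict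
    high c                        <⟨ m<m+n (high c) z<s ⟩
    high c + suc _                ≡⟨ order-bound (rows c) (spineLength c (low c)) (low c) ⟩
    suc (suc (rows c)) * block    ≤⟨ *-monoˡ-≤ block (subst (_≤ q + q) [2+c]+[2+c]≡4+2c (+-mono-≤ 2+c≤q 2+c≤q)) ⟩
    (q + q) * block               ≡⟨ *-distribʳ-+ block q q ⟩
    q * block + q * block         ∎
    where
    open ≤-Reasoning
    [2+c]+[2+c]≡4+2c : suc (suc c) + suc (suc c) ≡ suc (suc (rows c))
    [2+c]+[2+c]≡4+2c = cong (λ n → suc (suc n)) (trans (+-suc c (suc c)) (cong suc (+-suc c c)))

  module _ (X : Subset (high c)) (∣X∣≤c : ∣ X ∣ ≤ c) where
    private
      hit : Subset (rows c)
      hit = image rowOf X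
      2+c≤missed : suc (suc c) ≤ ∣ ∁ hit ∣
      2+c≤missed = begin
        suc (suc c)              ≡⟨ m+n∸n≡m (suc (suc c)) c ⟨
        rows c ∸ c               ≤⟨ ∸-monoʳ-≤ (rows c) (≤-trans (∣image∣≤∣p∣ rowOf X) ∣X∣≤c) ⟩
        rows c ∸ ∣ hit ∣         ≡⟨ ∣∁p∣≡n∸∣p∣ hit ⟨
        ∣ ∁ hit ∣                ∎
        where open ≤-Reasoning

    cycle-avoiding-hit-rows : Σ (Cycle graph) λ C → high c < len C + len C ×
                                                   (∀ {x} → OnCycle C x → rowOf x ∉ image rowOf X)
    cycle-avoiding-hit-rows
      with elements (∁ hit) | length-elements (∁ hit) | elements-unique (∁ hit) | elements-∈ (∁ hit)
    ... | []     | 0≡missed | _      | _      =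
      contradiction (subst (suc (suc c) ≤_) (sym 0≡missed) 2+c≤missed) λ ()
    ... | s ∷ ss | q≡missed | unique | missed with cycle-through-rows s ss unique
    ... | C , len≡ , rows-on-C =
      C , subst (λ l → high c < l + l) (sym len≡)
            (high<twice-tour (subst (suc (suc c) ≤_) (sym q≡missed) 2+c≤missed)) ,
      λ on → x∈∁p⇒x∉p (All.lookup missed (rows-on-C on))

module _ (L : SubsetN) (c : ℕ) where
  open Gadget c (low c)

  windowed-cycle⇒long : (C : Cycle graph) → IsLCycle (windowed L) C → high c < len C + len C
  windowed-cycle⇒long C isL =
    does⇒ (high c <? len C + len C) (trans (sym (windowed-in-window L {c} (cycle-in-window c C))) isL)

  long⇒windowed-cycle : (C : Cycle graph) → high c < len C + len C → IsLCycle (windowed L) C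
  long⇒windowed-cycle C long =
    trans (windowed-in-window L {c} (cycle-in-window c C)) (dec-true (high c <? len C + len C) long)

  no-two-disjoint-windowed-cycles : ¬ HasDisjointLCycles (windowed L) 2 graph
  no-two-disjoint-windowed-cycles (Cs , isL , disjoint) = <⇒≱ twice-high< (+-mono-≤ C+D≤high C+D≤high)
    where
    C D : Cycle graph
    C = Cs zero
    D = Cs (suc zero)
    C+D≤high : len C + len D ≤ high c
    C+D≤high = disjoint⇒len+len≤n C D (disjoint zero (suc zero) λ ())
    twice-high< : high c + high c < (len C + len D) + (len C + len D)
    twice-high< = begin-strict
      high c + high c                   <⟨ +-mono-< (windowed-cycle⇒long C (isL zero))
                                                    (windowed-cycle⇒long D (isL (suc zero))) ⟩
      (len C + len C) + (len D + len D) ≡⟨ interchange (len C) (len C) (len D) (len D) ⟩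
      (len C + len D) + (len C + len D) ∎
      where open ≤-Reasoning

  no-small-hitting-set : ∀ X → ∣ X ∣ ≤ c → ¬ HitsAllLCycles (windowed L) graph X
  no-small-hitting-set X ∣X∣≤c hits with cycle-avoiding-hit-rows c X ∣X∣≤c
  ... | C , long , avoids with hits C (long⇒windowed-cycle C long)
  ... | x , on , x∈X = avoids on (∈image rowOf X x∈X)

windowed-not-ErdosPosa : ∀ L → ¬ ErdosPosa (windowed L)
windowed-not-ErdosPosa L (f , ep) with ep 2 (Gadget.graph (f 2) (low (f 2)))
... | inj₁ packing             = no-two-disjoint-windowed-cycles L (f 2) packing
... | inj₂ (X , ∣X∣≤ , hits) = no-small-hitting-set L (f 2) X ∣X∣≤ hits

-- The construction works for every L.
corollary3p3 : (L : SubsetN) → ErdosPosa L →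
    Σ SubsetN (λ L′ → ¬ ErdosPosa L′ × LowerDensityZero (SymDiff L L′))
corollary3p3 L _ = windowed L , windowed-not-ErdosPosa L , symDiff-sparse L
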